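{- Let $n \geq 1$ and write $\varphi^n(2) = a^n_0 a^n_1 \cdots a^n_{3^n-1}$ (each $a^n_i \in \{1,2,3\}$). Then there is no integer $q \geq 0$ with $3q+11 \leq 3^n - 1$ such that $a^n_{3q} = a^n_{3q+3} = a^n_{3q+6} = a^n_{3q+9}$.
   Context: Words are over the alphabet $\{1,2,3\}$. For a word $a$, $\sigma(a)$ is the word obtained from $a$ by exchanging every $1$ with $2$ (and every $2$ with $1$), and $\rho(a)$ is the word obtained from $a$ by exchanging every $2$ with $3$. Define $\varphi(a) = \sigma(a)\,a\,\rho(a)$ (concatenation), and $\varphi^n$ denotes the $n$-fold iterate. Thus $\varphi^n(2)$ has length $3^n$; its letters are indexed from $0$ as $a^n_0 a^n_1 \cdots a^n_{3^n-1}$. -}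

module Defs where

open import Data.Nat using (ℕ; zero; suc)
open import Data.List using (List; []; _∷_; _++_; map; [_])
open import Data.Maybe using (Maybe; just; nothing)

data Letter : Set where
  l1 l2 l3 : Letter

σL : Letter → Letter
σL l1 = l2
σL l2 = l1
σL l3 = l3

ρL : Letter → Letter
ρL l1 = l1
ρL l2 = l3
ρL l3 = l2

Word : Set
Word = List Letter

σ : Word → Word
σ = map σL

ρ : Word → Word
ρ = map ρL

φ : Word → Word
φ a = σ a ++ a ++ ρ a

φ^ : ℕ → Word → Word
φ^ zero a = a
φ^ (suc n) a = φ (φ^ n a)

_!_ : Word → ℕ → Maybe Letter
[] ! _ = nothing
(x ∷ xs) ! zero = just x
(x ∷ xs) ! suc i = xs ! i

-- Every φ^n(2) with n ≥ 2 splits into blocks of length 9 which are images of φ²(2) = 213123132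
-- under compositions of σ and ρ, and letters are permuted bijectively by these maps. Since
-- a₀ = 2 ≠ 1 = a₃ in φ²(2), it follows that a_{9r} ≠ a_{9r+3} for every block r. Four equal
-- letters at 3q, 3q+3, 3q+6, 3q+9 would produce such an equal pair, because one of
-- 3q, 3q+3, 3q+6 is a multiple of 9.
module Submission where

open import Defs
open import Data.Nat using (ℕ; zero; suc; _+_; _*_; _^_; _∸_; _≤_; _<_; s≤s; z≤n; z<s)
open import Data.Nat.Properties
open import Data.Nat.Divisibility using (_∣_; divides; ∣-refl; ∣-trans; n∣m*n)
open import Data.List using ([]; _∷_; _++_; map; length; [_])
open import Data.List.Properties using (length-++; length-map)
open import Data.Maybe using (Maybe; nothing)
import Data.Maybe as Maybe
open import Data.Maybe.Properties using () renaming (map-injective to Maybe-map-injective)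
open import Data.Product using (Σ; ∃; _×_; _,_)
open import Data.Sum using (_⊎_; inj₁; inj₂)
import Data.Sum as Sum
open import Function.Definitions using (Injective; StrictlyInverseʳ)
open import Function.Consequences.Propositional using (inverseʳ⇒injective; strictlyInverseʳ⇒inverseʳ)
open import Data.Empty using (⊥)
open import Relation.Nullary using (¬_)
open import Relation.Binary.PropositionalEquality
  using (_≡_; _≢_; refl; sym; trans; cong; cong₂; subst; subst₂; module ≡-Reasoning)

!-++ˡ : (u v : Word) {i : ℕ} → i < length u → (u ++ v) ! i ≡ u ! i
!-++ˡ (x ∷ u) v {zero}  _         = refl
!-++ˡ (x ∷ u) v {suc i} (s≤s i<u) = !-++ˡ u v i<u

!-++ʳ : (u v : Word) {i j : ℕ} → i ≡ length u + j → (u ++ v) ! i ≡ v ! j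
!-++ʳ []      v refl = refl
!-++ʳ (x ∷ u) v refl = !-++ʳ u v refl

!-map : (f : Letter → Letter) (u : Word) (i : ℕ) → map f u ! i ≡ Maybe.map f (u ! i)
!-map f []      i       = refl
!-map f (x ∷ u) zero    = refl
!-map f (x ∷ u) (suc i) = !-map f u i

!-≥length : (u : Word) {i : ℕ} → length u ≤ i → u ! i ≡ nothing
!-≥length []      _         = refl
!-≥length (x ∷ u) (s≤s u≤i) = !-≥length u u≤i

!-<length : (u : Word) {i : ℕ} → i < length u → u ! i ≢ nothing
!-<length (x ∷ u) {zero}  _         ()
!-<length (x ∷ u) {suc i} (s≤s i<u) = !-<length u i<u

involutive⇒injective : {A : Set} {f : A → A} → StrictlyInverseʳ _≡_ f f → Injective _≡_ _≡_ f
involutive⇒injective {f = f} f∘f≗id = inverseʳ⇒injective {f⁻¹ = f} f (strictlyInverseʳ⇒inverseʳ f f∘f≗id)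

σL-injective : Injective _≡_ _≡_ σL
σL-injective = involutive⇒injective λ { l1 → refl ; l2 → refl ; l3 → refl }

ρL-injective : Injective _≡_ _≡_ ρL
ρL-injective = involutive⇒injective λ { l1 → refl ; l2 → refl ; l3 → refl }

length-φ : (w : Word) → length (φ w) ≡ 3 * length w
length-φ w = begin
  length (σ w ++ w ++ ρ w)                   ≡⟨ length-++ (σ w) ⟩
  length (σ w) + length (w ++ ρ w)           ≡⟨ cong (length (σ w) +_) (length-++ w) ⟩
  length (σ w) + (length w + length (ρ w))   ≡⟨ cong₂ (λ a c → a + (l + c)) (length-map σL w) (length-map ρL w) ⟩
  l + (l + l)                                ≡⟨ cong (λ c → l + (l + c)) (sym (+-identityʳ l)) ⟩
  3 * l                                      ∎
  where
  open ≡-Reasoning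
  l = length w

length-φ^ : (n : ℕ) (w : Word) → length (φ^ n w) ≡ 3 ^ n * length w
length-φ^ zero    w = sym (+-identityʳ (length w))
length-φ^ (suc n) w = begin
  length (φ (φ^ n w))       ≡⟨ length-φ (φ^ n w) ⟩
  3 * length (φ^ n w)       ≡⟨ cong (3 *_) (length-φ^ n w) ⟩
  3 * (3 ^ n * length w)    ≡⟨ sym (*-assoc 3 (3 ^ n) (length w)) ⟩
  3 ^ suc n * length w      ∎
  where open ≡-Reasoning

∣-length-φ : ∀ {m} (w : Word) → m ∣ length w → m ∣ length (φ w)
∣-length-φ w m∣w = subst (_ ∣_) (sym (length-φ w)) (∣-trans m∣w (n∣m*n 3))

-- Two lookups are apart when they differ or both fall off the end of the word; phrasing the
-- separation property this way avoids carrying index bounds through concatenations.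
Apart : Maybe Letter → Maybe Letter → Set
Apart x y = x ≡ y → x ≡ nothing

Apart-map : ∀ {f x y} → Injective _≡_ _≡_ f → Apart x y → Apart (Maybe.map f x) (Maybe.map f y)
Apart-map {f} f-inj x#y fx≡fy = cong (Maybe.map f) (x#y (Maybe-map-injective f-inj fx≡fy))

Separated : ℕ → ℕ → Word → Set
Separated m d w = ∀ r → Apart (w ! (m * r)) (w ! (m * r + d))

separated-map : ∀ {m d f} (w : Word) → Injective _≡_ _≡_ f →
                Separated m d w → Separated m d (map f w)
separated-map {m} {d} {f} w f-inj sep r =
  subst₂ Apart (sym (!-map f w (m * r))) (sym (!-map f w (m * r + d)))
               (Apart-map {f} {w ! (m * r)} f-inj (sep r))

separated-++ : ∀ {m d} (u v : Word) → d < m → m ∣ length u →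
               Separated m d u → Separated m d v → Separated m d (u ++ v)
separated-++ {m} {d} u v d<m (divides k |u|≡km) sep-u sep-v r with <-≤-connex r k
... | inj₁ r<k =
  subst₂ Apart (sym (!-++ˡ u v (≤-<-trans (m≤m+n (m * r) d) mr+d<|u|)))
               (sym (!-++ˡ u v mr+d<|u|))
               (sep-u r)
  where
  open ≤-Reasoning
  mr+d<|u| : m * r + d < length u
  mr+d<|u| = begin-strict
    m * r + d   <⟨ +-monoʳ-< (m * r) d<m ⟩
    m * r + m   ≡⟨ trans (+-comm (m * r) m) (sym (*-suc m r)) ⟩
    m * suc r   ≤⟨ *-monoʳ-≤ m r<k ⟩
    m * k       ≡⟨ trans (*-comm m k) (sym |u|≡km) ⟩
    length u    ∎
... | inj₂ k≤r with m≤n⇒∃[o]m+o≡n k≤r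
...   | j , refl = subst₂ Apart (sym (!-++ʳ u v mr≡|u|+mj))
                     (sym (!-++ʳ u v (trans (cong (_+ d) mr≡|u|+mj) (+-assoc (length u) (m * j) d))))
                     (sep-v j)
  where
  mr≡|u|+mj : m * (k + j) ≡ length u + m * j
  mr≡|u|+mj = trans (*-distribˡ-+ m k j) (cong (_+ m * j) (trans (*-comm m k) (sym |u|≡km)))

separated⇒≢ : ∀ {m d} {w : Word} → Separated m d w →
              ∀ r → m * r < length w → w ! (m * r) ≢ w ! (m * r + d)
separated⇒≢ {w = w} sep r mr<|w| eq = !-<length w mr<|w| (sep r eq)

separated-φ : ∀ {m d} (w : Word) → d < m → m ∣ length w → Separated m d w → Separated m d (φ w)
separated-φ {m} {d} w d<m m∣w sep =
  separated-++ (σ w) (w ++ ρ w) d<m (subst (m ∣_) (sym (length-map σL w)) m∣w)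
    (separated-map {m} {d} w σL-injective sep)
    (separated-++ w (ρ w) d<m m∣w sep (separated-map {m} {d} w ρL-injective sep))

φ²[2] : Word
φ²[2] = φ^ 2 [ l2 ]

separated-φ²[2] : Separated 9 3 φ²[2]
separated-φ²[2] zero    ()
separated-φ²[2] (suc r) _ = !-≥length φ²[2] (*-monoʳ-≤ 9 {1} {suc r} (s≤s z≤n))

∣-length-φ^[2+k] : ∀ k → 9 ∣ length (φ^ (2 + k) [ l2 ])
∣-length-φ^[2+k] zero    = ∣-refl
∣-length-φ^[2+k] (suc k) = ∣-length-φ (φ^ (2 + k) [ l2 ]) (∣-length-φ^[2+k] k)

separated-φ^[2+k] : ∀ k → Separated 9 3 (φ^ (2 + k) [ l2 ])
separated-φ^[2+k] zero    = separated-φ²[2]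
separated-φ^[2+k] (suc k) =
  separated-φ (φ^ (2 + k) [ l2 ]) (m<m+n 3 z<s) (∣-length-φ^[2+k] k) (separated-φ^[2+k] k)

nine-divides-3q-or-3q+3-or-3q+6 : ∀ q → ∃ λ r → 3 * q ≡ 9 * r ⊎ 3 * q + 3 ≡ 9 * r ⊎ 3 * q + 6 ≡ 9 * r
nine-divides-3q-or-3q+3-or-3q+6 0 = 0 , inj₁ refl
nine-divides-3q-or-3q+3-or-3q+6 1 = 1 , inj₂ (inj₂ refl)
nine-divides-3q-or-3q+3-or-3q+6 2 = 1 , inj₂ (inj₁ refl)
nine-divides-3q-or-3q+3-or-3q+6 (suc (suc (suc q))) with nine-divides-3q-or-3q+3-or-3q+6 q
... | r , i≡9r =
  suc r , Sum.map (next shift) (Sum.map (next (cong (_+ 3) shift)) (next (cong (_+ 6) shift))) i≡9r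
  where
  shift : 3 * (3 + q) ≡ 9 + 3 * q
  shift = *-distribˡ-+ 3 3 q
  next : ∀ {i i′} → i ≡ 9 + i′ → i′ ≡ 9 * r → i ≡ 9 * suc r
  next i≡9+i′ i′≡9r = trans i≡9+i′ (trans (cong (9 +_) i′≡9r) (sym (*-suc 9 r)))

lemma4 : (n : ℕ) → 1 ≤ n →
    ¬ (Σ ℕ (λ q → (3 * q + 11 ≤ 3 ^ n ∸ 1) ×
    ((φ^ n [ l2 ] ! (3 * q) ≡ φ^ n [ l2 ] ! (3 * q + 3)) ×
    (φ^ n [ l2 ] ! (3 * q + 3) ≡ φ^ n [ l2 ] ! (3 * q + 6)) ×
    (φ^ n [ l2 ] ! (3 * q + 6) ≡ φ^ n [ l2 ] ! (3 * q + 9)))))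
lemma4 1 _ (q , 3q+11≤2 , _) = <⇒≱ (m<m+n 2 z<s) (≤-trans (m≤n+m 11 (3 * q)) 3q+11≤2)
lemma4 (suc (suc k)) _ (q , bound , e₀ , e₃ , e₆) = excluded (nine-divides-3q-or-3q+3-or-3q+6 q)
  where
  w : Word
  w = φ^ (2 + k) [ l2 ]
  in-range : ∀ {i} → i ≤ 3 * q + 6 → i < length w
  in-range {i} i≤ = begin-strict
    i                   ≤⟨ i≤ ⟩
    3 * q + 6           <⟨ +-monoʳ-< (3 * q) (m<m+n 6 z<s) ⟩
    3 * q + 11          ≤⟨ bound ⟩
    3 ^ (2 + k) ∸ 1     ≤⟨ m∸n≤m _ 1 ⟩
    3 ^ (2 + k)         ≡⟨ sym (trans (length-φ^ (2 + k) [ l2 ]) (*-identityʳ _)) ⟩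
    length w            ∎
    where open ≤-Reasoning
  distinct : ∀ {i j} r → i ≡ 9 * r → j ≡ 9 * r + 3 → i ≤ 3 * q + 6 → w ! i ≢ w ! j
  distinct r refl refl i≤ = separated⇒≢ {9} {3} {w} (separated-φ^[2+k] k) r (in-range i≤)
  +3 : ∀ {c} r → 3 * q + c ≡ 9 * r → 3 * q + (c + 3) ≡ 9 * r + 3
  +3 {c} r p = trans (sym (+-assoc (3 * q) c 3)) (cong (_+ 3) p)
  excluded : ∃ (λ r → 3 * q ≡ 9 * r ⊎ 3 * q + 3 ≡ 9 * r ⊎ 3 * q + 6 ≡ 9 * r) → ⊥
  excluded (r , inj₁ p)        = distinct r p (cong (_+ 3) p) (m≤m+n (3 * q) 6) e₀
  excluded (r , inj₂ (inj₁ p)) = distinct r p (+3 r p) (+-monoʳ-≤ (3 * q) (m≤m+n 3 3)) e₃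
  excluded (r , inj₂ (inj₂ p)) = distinct r p (+3 r p) ≤-refl e₆
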